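{- Let $A$ be a $\mathbb{Z}$-torsion-free $\mathbb{Z}_{(p)}$-algebra, $\mathfrak{a}\subseteq A$ a divided-power ideal, $P, Q \in A[X]$ monic polynomials, and $N \geq 1$. If $p_n(P) \equiv p_n(Q) \pmod{n\mathfrak{a}}$ for all $1 \leq n \leq N$, then $e_n(P) \equiv e_n(Q) \pmod{\mathfrak{a}}$ for all $1 \leq n \leq N$.
   Context: $p$ is a prime and $\mathbb{Z}_{(p)}\subseteq\mathbb{Q}$ is the ring of rationals with denominator prime to $p$. An ideal $\mathfrak{a}$ of $A$ is a divided-power ideal if $a^k/k!\in\mathfrak{a}$ (equivalently $a^k\in k!\,\mathfrak{a}$) for all $a\in\mathfrak{a}$, $k\ge1$. For a monic $Q = X^d + a_1X^{d-1}+\cdots+a_d$: $e_0(Q)=1$, $e_n(Q) = (-1)^n a_n$ for $1\le n\le d$, $e_n(Q)=0$ for $n>d$. $p_n(Q)$ is obtained by writing the power-sum symmetric function $p_n=\sum_i x_i^n$ as an integer polynomial in the elementary symmetric functions $e_1,e_2,\dots$ and substituting $e_k(Q)$ for $e_k$ (for $A$ a domain it is the sum of $n$-th powers of the roots of $Q$ with multiplicity). -}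

module Defs where

open import Level using (Level; _⊔_)
open import Algebra.Bundles using (CommutativeRing; Semiring)
open import Data.Nat as ℕ using (ℕ; zero; suc; _∸_; _!)
open import Data.Nat.Divisibility renaming (_∣_ to _∣ℕ_)
open import Data.List using (List; []; _∷_; length)
open import Data.Product using (Σ; _×_)
open import Relation.Nullary using (¬_)

module _ {c ℓ : Level} (R : CommutativeRing c ℓ) where
  open CommutativeRing R
  open import Algebra.Definitions.RawSemiring (Semiring.rawSemiring semiring)
    using () renaming (_×_ to _·ℕ_; _^_ to _^_)

  natMul : ℕ → Carrier → Carrier
  natMul = _·ℕ_

  pow : Carrier → ℕ → Carrier
  pow = _^_

  TorsionFree : Set (c ⊔ ℓ)
  TorsionFree = ∀ (n : ℕ) (x : Carrier) → natMul (suc n) x ≈ 0# → x ≈ 0#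

  -- A is a Z_(p)-algebra: every integer prime to p is invertible in A
  -- (the Z-algebra structure of a ring is unique, so this is exactly the condition)
  ZpAlgebra : ℕ → Set (c ⊔ ℓ)
  ZpAlgebra p = ∀ (m : ℕ) → ¬ (p ∣ℕ m) → Σ Carrier (λ y → natMul m 1# * y ≈ 1#)

  record IsIdeal {a : Level} (I : Carrier → Set a) : Set (c ⊔ ℓ ⊔ a) where
    field
      resp : ∀ {x y} → x ≈ y → I x → I y
      zero∈ : I 0#
      +-closed : ∀ {x y} → I x → I y → I (x + y)
      *-closed : ∀ x {y} → I y → I (x * y)

  DividedPower : {a : Level} → (Carrier → Set a) → Set (c ⊔ ℓ ⊔ a)
  DividedPower I = ∀ (x : Carrier) → I x → ∀ (k : ℕ) → 1 ℕ.≤ k →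
    Σ Carrier (λ b → I b × (pow x k ≈ natMul (k !) b))

  CongModMul : {a : Level} → (Carrier → Set a) → ℕ → Carrier → Carrier → Set (c ⊔ ℓ ⊔ a)
  CongModMul I n x y = Σ Carrier (λ b → I b × (x - y ≈ natMul n b))

  CongMod : {a : Level} → (Carrier → Set a) → Carrier → Carrier → Set a
  CongMod I x y = I (x - y)

  negPow : ℕ → Carrier
  negPow zero = 1#
  negPow (suc k) = - negPow k

  -- A monic polynomial Q = X^d + a_1 X^(d-1) + ... + a_d in A[X] is represented
  -- by the list [a_1, ..., a_d] of its non-leading coefficients (d = length).
  MonicPoly : Set c
  MonicPoly = List Carrier

  -- a_(k+1), and 0 beyond the degree
  coeff : MonicPoly → ℕ → Carrier
  coeff [] k = 0#
  coeff (a ∷ as) zero = a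
  coeff (a ∷ as) (suc k) = coeff as k

  e : MonicPoly → ℕ → Carrier
  e Q zero = 1#
  e Q (suc k) = negPow (suc k) * coeff Q k

  -- Newton's identities: the integer polynomial expressing p_m in e_1, e_2, ...
  --   p_m = Σ_{i=1}^{m-1} (-1)^(i-1) e_i p_(m-i) + (-1)^(m-1) m e_m,
  -- evaluated at e_k = e_k(Q).  `prev` is [p_(m-1), ..., p_1].
  newtonSum : MonicPoly → ℕ → List Carrier → Carrier
  newtonSum Q i [] = 0#
  newtonSum Q i (x ∷ xs) = negPow (i ∸ 1) * e Q i * x + newtonSum Q (suc i) xs

  newton : MonicPoly → ℕ → List Carrier → Carrier
  newton Q m prev = newtonSum Q 1 prev + negPow (m ∸ 1) * natMul m (e Q m)

  powerSumsRev : MonicPoly → ℕ → List Carrier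
  powerSumsRev Q zero = []
  powerSumsRev Q (suc n) = newton Q (suc n) (powerSumsRev Q n) ∷ powerSumsRev Q n

  -- p_n(Q); p_0(Q) = d (number of roots)
  powerSum : MonicPoly → ℕ → Carrier
  powerSum Q zero = natMul (length Q) 1#
  powerSum Q (suc n) = newton Q (suc n) (powerSumsRev Q n)

{-# OPTIONS --safe #-}
-- Encode a monic Q by its reversed polynomial A_Q = 1 + a₁t + ⋯ + a_d t^d and its power
-- sums S_Q = Σₙ pₙ(Q) tⁿ; Newton's identities say exactly that S_Q is the logarithmic
-- derivative −tA_Q′/A_Q. Write pₙ(P) − pₙ(Q) = n·bₙ with bₙ ∈ 𝔞 for n ≤ N. Divided powers
-- make exp(−bₙtⁿ) = Σ_q (−bₙ)^q/q! · t^(qn) a series ≡ 1 mod 𝔞, with log-derivative n·bₙtⁿ;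
-- so E = Πₙ≤N exp(−bₙtⁿ) ≡ 1 mod 𝔞 and A_Q·E has log-derivative S_Q + Σₙ≤N n·bₙtⁿ, which
-- agrees with S_P up to degree N. Over a torsion-free ring a series with constant term 1
-- is determined up to degree N by its log-derivative up to degree N, hence
-- A_P ≡ A_Q·E ≡ A_Q mod 𝔞 up to degree N, and eₙ = (−1)ⁿaₙ.
module Submission where

open import Defs
open import Level using (Level; _⊔_)
open import Algebra.Bundles using (CommutativeRing)
open import Data.Nat as ℕ using (ℕ; zero; suc; _≤_; _<_; z≤n; s≤s; NonZero; _!)
import Data.Nat.Properties as ℕₚ
open ℕₚ using (≤-refl; ≤-trans; ≤-pred; <⇒≤; m≤n⇒m≤1+n; m≤n⇒m<n∨m≡n; n<1+n; <-irrefl)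
open import Data.Nat.Primality using (Prime)
open import Data.Product using (Σ; _,_; proj₁; proj₂; _×_)
open import Relation.Binary.PropositionalEquality as ≡ using (_≡_; _≢_; cong)

module IntegerCoefficients {c ℓ : Level} (R : CommutativeRing c ℓ) where
  open import Algebra.Solver.Ring.AlmostCommutativeRing
    using (fromCommutativeRing; _-Raw-AlmostCommutative⟶_)
  open import Data.Integer as ℤ using (ℤ; +_; -[1+_])
  open import Data.Integer.Properties using ([1+m]⊖[1+n]≡m⊖n; +◃n≡+n; -◃n≡-n)
  open import Data.Sign as Sign using ()
  open import Data.Maybe using (map)
  open import Relation.Nullary.Decidable using (dec⇒maybe)
  open CommutativeRing R
  open import Algebra.Properties.Ring ring
    using (-0#≈0#; -‿involutive; -‿distribˡ-*; -‿distribʳ-*; -‿+-comm)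
  -- the TC-optimised multiple satisfies 1 · x = x definitionally, as the solver's
  -- normal forms need ⟦ + 1 ⟧ to be 1# on the nose
  open import Algebra.Properties.Semiring.Mult.TCOptimised semiring
    using (×-homo-+; ×1-homo-*; 1+×) renaming (_×_ to _·_)
  open import Algebra.Properties.CommutativeSemigroup +-commutativeSemigroup using (interchange)
  open import Relation.Binary.Reasoning.Setoid setoid

  private
    ⟦_⟧ : ℤ → Carrier
    ⟦ + n ⟧ = n · 1#
    ⟦ -[1+ n ] ⟧ = - (suc n · 1#)

    ⟦⟧-homo-‿ : ∀ i → ⟦ ℤ.- i ⟧ ≈ - ⟦ i ⟧
    ⟦⟧-homo-‿ (+ zero) = sym -0#≈0#
    ⟦⟧-homo-‿ (+ suc n) = refl
    ⟦⟧-homo-‿ -[1+ n ] = sym (-‿involutive _)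

    ⟦⟧-homo-⊖ : ∀ m n → ⟦ m ℤ.⊖ n ⟧ ≈ m · 1# - n · 1#
    ⟦⟧-homo-⊖ zero zero = sym (-‿inverseʳ 0#)
    ⟦⟧-homo-⊖ zero (suc n) = sym (+-identityˡ _)
    ⟦⟧-homo-⊖ (suc m) zero = sym (trans (+-congˡ -0#≈0#) (+-identityʳ _))
    ⟦⟧-homo-⊖ (suc m) (suc n) = begin
      ⟦ suc m ℤ.⊖ suc n ⟧       ≡⟨ cong ⟦_⟧ ([1+m]⊖[1+n]≡m⊖n m n) ⟩
      ⟦ m ℤ.⊖ n ⟧               ≈⟨ ⟦⟧-homo-⊖ m n ⟩
      a - b                     ≈⟨ +-identityˡ _ ⟨
      0# + (a - b)              ≈⟨ +-congʳ (-‿inverseʳ 1#) ⟨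
      (1# - 1#) + (a - b)       ≈⟨ interchange 1# (- 1#) a (- b) ⟩
      (1# + a) + (- 1# + - b)   ≈⟨ +-congˡ (-‿+-comm 1# b) ⟩
      (1# + a) - (1# + b)       ≈⟨ +-cong (1+× m 1#) (-‿cong (1+× n 1#)) ⟨
      suc m · 1# - suc n · 1#   ∎
      where a = m · 1#
            b = n · 1#

    ⟦⟧-homo-+ : ∀ i j → ⟦ i ℤ.+ j ⟧ ≈ ⟦ i ⟧ + ⟦ j ⟧
    ⟦⟧-homo-+ (+ m) (+ n) = ×-homo-+ 1# m n
    ⟦⟧-homo-+ (+ m) -[1+ n ] = ⟦⟧-homo-⊖ m (suc n)
    ⟦⟧-homo-+ -[1+ m ] (+ n) = trans (⟦⟧-homo-⊖ n (suc m)) (+-comm _ _)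
    ⟦⟧-homo-+ -[1+ m ] -[1+ n ] = begin
      - (suc (suc (m ℕ.+ n)) · 1#)  ≡⟨ cong (λ k → - (k · 1#)) (ℕₚ.+-suc (suc m) n) ⟨
      - ((suc m ℕ.+ suc n) · 1#)    ≈⟨ -‿cong (×-homo-+ 1# (suc m) (suc n)) ⟩
      - (suc m · 1# + suc n · 1#)   ≈⟨ -‿+-comm _ _ ⟨
      - (suc m · 1#) + - (suc n · 1#) ∎

    ⟦⟧-homo-* : ∀ i j → ⟦ i ℤ.* j ⟧ ≈ ⟦ i ⟧ * ⟦ j ⟧
    ⟦⟧-homo-* (+ m) (+ n) = trans (reflexive (cong ⟦_⟧ (+◃n≡+n (m ℕ.* n)))) (×1-homo-* m n)
    ⟦⟧-homo-* (+ m) -[1+ n ] = begin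
      ⟦ Sign.- ℤ.◃ (m ℕ.* suc n) ⟧ ≡⟨ cong ⟦_⟧ (-◃n≡-n (m ℕ.* suc n)) ⟩
      ⟦ ℤ.- (+ (m ℕ.* suc n)) ⟧ ≈⟨ ⟦⟧-homo-‿ (+ (m ℕ.* suc n)) ⟩
      - ((m ℕ.* suc n) · 1#)    ≈⟨ -‿cong (×1-homo-* m (suc n)) ⟩
      - (m · 1# * suc n · 1#)   ≈⟨ -‿distribʳ-* _ _ ⟩
      m · 1# * - (suc n · 1#)   ∎
    ⟦⟧-homo-* -[1+ m ] (+ n) = begin
      ⟦ Sign.- ℤ.◃ (suc m ℕ.* n) ⟧ ≡⟨ cong ⟦_⟧ (-◃n≡-n (suc m ℕ.* n)) ⟩
      ⟦ ℤ.- (+ (suc m ℕ.* n)) ⟧ ≈⟨ ⟦⟧-homo-‿ (+ (suc m ℕ.* n)) ⟩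
      - ((suc m ℕ.* n) · 1#)    ≈⟨ -‿cong (×1-homo-* (suc m) n) ⟩
      - (suc m · 1# * n · 1#)   ≈⟨ -‿distribˡ-* _ _ ⟩
      - (suc m · 1#) * n · 1#   ∎
    ⟦⟧-homo-* -[1+ m ] -[1+ n ] = begin
      (suc m ℕ.* suc n) · 1#    ≈⟨ ×1-homo-* (suc m) (suc n) ⟩
      a * b                     ≈⟨ -‿involutive _ ⟨
      - - (a * b)               ≈⟨ -‿cong (-‿distribˡ-* _ _) ⟩
      - (- a * b)               ≈⟨ -‿distribʳ-* _ _ ⟩
      - a * - b                 ∎
      where a = suc m · 1#
            b = suc n · 1#

    ℤ⟶R : ℤ.+-*-rawRing -Raw-AlmostCommutative⟶ fromCommutativeRing R
    ℤ⟶R = record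
      { ⟦_⟧ = ⟦_⟧ ; +-homo = ⟦⟧-homo-+ ; *-homo = ⟦⟧-homo-* ; -‿homo = ⟦⟧-homo-‿
      ; 0-homo = refl ; 1-homo = refl }

  open import Algebra.Solver.Ring ℤ.+-*-rawRing (fromCommutativeRing R) ℤ⟶R
    (λ i j → map (λ i≡j → reflexive (cong ⟦_⟧ i≡j)) (dec⇒maybe (i ℤ.≟ j)))
    public using (solve; _:+_; _:*_; :-_; _:=_; con)

module PowerSeries {c ℓ : Level} (R : CommutativeRing c ℓ) where
  open import Data.Empty using (⊥-elim)
  open import Data.Integer using (+_)
  open import Data.Sum using (inj₁; inj₂)
  open CommutativeRing R
  open IntegerCoefficients R using (solve; _:+_; _:*_; :-_; _:=_; con)
  open import Algebra.Properties.Ring ring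
    using (-0#≈0#; -‿involutive; -‿distribˡ-*; -‿distribʳ-*; -‿+-comm; x[y-z]≈xy-xz;
           x∙y⁻¹≈ε⇒x≈y; +-inverseˡ-unique)
  open import Algebra.Properties.Semiring.Mult semiring using (×-assoc-*; ×-congʳ)
  open import Algebra.Properties.CommutativeSemigroup +-commutativeSemigroup using (interchange)
  open import Algebra.Properties.CommutativeSemigroup *-commutativeSemigroup using (x∙yz≈y∙xz)
  open import Relation.Binary.Reasoning.Setoid setoid

  Series : Set c
  Series = ℕ → Carrier

  infix 4 _≈ₛ_ _≈[≤_]_
  infixl 6 _⊕_
  infixl 7 _⋆_

  _≈ₛ_ : Series → Series → Set ℓ
  f ≈ₛ g = ∀ n → f n ≈ g n

  _≈[≤_]_ : Series → ℕ → Series → Set ℓ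
  f ≈[≤ n ] g = ∀ i → i ≤ n → f i ≈ g i

  ≈[≤]-extend : ∀ {f g} n → f ≈[≤ n ] g → f (suc n) ≈ g (suc n) → f ≈[≤ suc n ] g
  ≈[≤]-extend n f≈g f≈g-at-1+n i i≤1+n with m≤n⇒m<n∨m≡n i≤1+n
  ... | inj₁ i<1+n = f≈g i (≤-pred i<1+n)
  ... | inj₂ ≡.refl = f≈g-at-1+n

  _⊕_ : Series → Series → Series
  (f ⊕ g) n = f n + g n

  shift : Series → Series
  shift f n = f (suc n)

  _⋆_ : Series → Series → Series
  (f ⋆ g) zero = f 0 * g 0
  (f ⋆ g) (suc n) = f 0 * g (suc n) + (shift f ⋆ g) n

  ⋆-cong-≤ : ∀ {f f′ g g′} n → f ≈[≤ n ] f′ → g ≈[≤ n ] g′ → (f ⋆ g) n ≈ (f′ ⋆ g′) n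
  ⋆-cong-≤ zero f≈ g≈ = *-cong (f≈ 0 z≤n) (g≈ 0 z≤n)
  ⋆-cong-≤ (suc n) f≈ g≈ = +-cong (*-cong (f≈ 0 z≤n) (g≈ (suc n) ≤-refl))
    (⋆-cong-≤ n (λ i i≤n → f≈ (suc i) (s≤s i≤n)) (λ i i≤n → g≈ i (m≤n⇒m≤1+n i≤n)))

  ⋆-cong : ∀ {f f′ g g′} → f ≈ₛ f′ → g ≈ₛ g′ → f ⋆ g ≈ₛ f′ ⋆ g′
  ⋆-cong f≈ g≈ n = ⋆-cong-≤ n (λ i _ → f≈ i) (λ i _ → g≈ i)

  ⋆-shiftʳ : ∀ f g n → (f ⋆ g) (suc n) ≈ (f ⋆ shift g) n + f (suc n) * g 0
  ⋆-shiftʳ f g zero = refl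
  ⋆-shiftʳ f g (suc n) = begin
    f 0 * g (suc (suc n)) + (shift f ⋆ g) (suc n)
      ≈⟨ +-congˡ (⋆-shiftʳ (shift f) g n) ⟩
    f 0 * g (suc (suc n)) + ((shift f ⋆ shift g) n + f (suc (suc n)) * g 0)
      ≈⟨ +-assoc _ _ _ ⟨
    (f ⋆ shift g) (suc n) + f (suc (suc n)) * g 0 ∎

  ⋆-comm : ∀ f g → f ⋆ g ≈ₛ g ⋆ f
  ⋆-comm f g zero = *-comm _ _
  ⋆-comm f g (suc n) = begin
    f 0 * g (suc n) + (shift f ⋆ g) n ≈⟨ +-cong (*-comm _ _) (⋆-comm (shift f) g n) ⟩
    g (suc n) * f 0 + (g ⋆ shift f) n ≈⟨ +-comm _ _ ⟩
    (g ⋆ shift f) n + g (suc n) * f 0 ≈⟨ ⋆-shiftʳ g f n ⟨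
    (g ⋆ f) (suc n)                   ∎

  ⋆-zeroʳ : ∀ f {g} → (∀ i → g i ≈ 0#) → ∀ n → (f ⋆ g) n ≈ 0#
  ⋆-zeroʳ f g≈0 zero = trans (*-congˡ (g≈0 0)) (zeroʳ _)
  ⋆-zeroʳ f g≈0 (suc n) =
    trans (+-cong (trans (*-congˡ (g≈0 (suc n))) (zeroʳ _)) (⋆-zeroʳ (shift f) g≈0 n)) (+-identityʳ 0#)

  ⋆-zeroˡ : ∀ {f} → (∀ i → f i ≈ 0#) → ∀ g n → (f ⋆ g) n ≈ 0#
  ⋆-zeroˡ {f} f≈0 g n = trans (⋆-comm f g n) (⋆-zeroʳ g f≈0 n)

  ⋆-distribʳ : ∀ f g h → (f ⊕ g) ⋆ h ≈ₛ f ⋆ h ⊕ g ⋆ h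
  ⋆-distribʳ f g h zero = distribʳ _ _ _
  ⋆-distribʳ f g h (suc n) = begin
    (f 0 + g 0) * h (suc n) + ((shift f ⊕ shift g) ⋆ h) n
      ≈⟨ +-cong (distribʳ _ _ _) (⋆-distribʳ (shift f) (shift g) h n) ⟩
    (f 0 * h (suc n) + g 0 * h (suc n)) + ((shift f ⋆ h) n + (shift g ⋆ h) n)
      ≈⟨ interchange _ _ _ _ ⟩
    (f ⋆ h) (suc n) + (g ⋆ h) (suc n) ∎

  ⋆-distribˡ : ∀ f g h → f ⋆ (g ⊕ h) ≈ₛ f ⋆ g ⊕ f ⋆ h
  ⋆-distribˡ f g h n = begin
    (f ⋆ (g ⊕ h)) n           ≈⟨ ⋆-comm f _ n ⟩
    ((g ⊕ h) ⋆ f) n           ≈⟨ ⋆-distribʳ g h f n ⟩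
    (g ⋆ f) n + (h ⋆ f) n     ≈⟨ +-cong (⋆-comm g f n) (⋆-comm h f n) ⟩
    (f ⋆ g) n + (f ⋆ h) n     ∎

  ⋆-scaleˡ : ∀ a f g → (λ k → a * f k) ⋆ g ≈ₛ (λ k → a * (f ⋆ g) k)
  ⋆-scaleˡ a f g zero = *-assoc _ _ _
  ⋆-scaleˡ a f g (suc n) = begin
    a * f 0 * g (suc n) + ((λ k → a * f (suc k)) ⋆ g) n
      ≈⟨ +-cong (*-assoc _ _ _) (⋆-scaleˡ a (shift f) g n) ⟩
    a * (f 0 * g (suc n)) + a * (shift f ⋆ g) n
      ≈⟨ distribˡ _ _ _ ⟨
    a * (f ⋆ g) (suc n) ∎

  ⋆-assoc : ∀ f g h → (f ⋆ g) ⋆ h ≈ₛ f ⋆ (g ⋆ h)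
  ⋆-assoc f g h zero = *-assoc _ _ _
  ⋆-assoc f g h (suc n) = begin
    f 0 * g 0 * h (suc n) + (((λ k → f 0 * g (suc k)) ⊕ shift f ⋆ g) ⋆ h) n
      ≈⟨ +-congˡ (⋆-distribʳ (λ k → f 0 * g (suc k)) (shift f ⋆ g) h n) ⟩
    f 0 * g 0 * h (suc n) + (((λ k → f 0 * g (suc k)) ⋆ h) n + ((shift f ⋆ g) ⋆ h) n)
      ≈⟨ +-congˡ (+-cong (⋆-scaleˡ (f 0) (shift g) h n) (⋆-assoc (shift f) g h n)) ⟩
    f 0 * g 0 * h (suc n) + (f 0 * (shift g ⋆ h) n + (shift f ⋆ (g ⋆ h)) n)
      ≈⟨ +-assoc _ _ _ ⟨
    (f 0 * g 0 * h (suc n) + f 0 * (shift g ⋆ h) n) + (shift f ⋆ (g ⋆ h)) n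
      ≈⟨ +-congʳ (trans (+-congʳ (*-assoc _ _ _)) (sym (distribˡ _ _ _))) ⟩
    (f ⋆ (g ⋆ h)) (suc n) ∎

  fromℕ : ℕ → Carrier
  fromℕ n = natMul R n 1#

  natMul≈fromℕ* : ∀ n x → natMul R n x ≈ fromℕ n * x
  natMul≈fromℕ* n x = sym (trans (×-assoc-* n 1# x) (×-congʳ n (*-identityˡ x)))

  fromℕ-*-cancelˡ : TorsionFree R → ∀ n .{{_ : NonZero n}} {x y} → fromℕ n * x ≈ fromℕ n * y → x ≈ y
  fromℕ-*-cancelˡ tf (suc n) {x} {y} nx≈ny = x∙y⁻¹≈ε⇒x≈y x y (tf n (x - y) (begin
    natMul R (suc n) (x - y)              ≈⟨ natMul≈fromℕ* (suc n) _ ⟩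
    fromℕ (suc n) * (x - y)               ≈⟨ x[y-z]≈xy-xz _ _ _ ⟩
    fromℕ (suc n) * x - fromℕ (suc n) * y ≈⟨ +-congʳ nx≈ny ⟩
    fromℕ (suc n) * y - fromℕ (suc n) * y ≈⟨ -‿inverseʳ _ ⟩
    0#                                    ∎))

  θ : Series → Series
  θ f n = fromℕ n * f n

  shift-θ : ∀ f → shift (θ f) ≈ₛ shift f ⊕ θ (shift f)
  shift-θ f n = trans (distribʳ _ _ _) (+-congʳ (*-identityˡ _))

  θ-⋆ : ∀ f g → θ (f ⋆ g) ≈ₛ θ f ⋆ g ⊕ f ⋆ θ g
  θ-⋆ f g zero =
    solve 2 (λ a b → con (+ 0) :* (a :* b) := con (+ 0) :* a :* b :+ a :* (con (+ 0) :* b))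
      refl (f 0) (g 0)
  θ-⋆ f g (suc n) = begin
    (1# + fromℕ n) * (f 0 * g (suc n) + C)
      ≈⟨ solve 4 (λ m a b c → (con (+ 1) :+ m) :* (a :* b :+ c)
                           := (con (+ 1) :+ m) :* a :* b :+ (c :+ m :* c))
           refl (fromℕ n) (f 0) (g (suc n)) C ⟩
    (1# + fromℕ n) * f 0 * g (suc n) + (C + fromℕ n * C)
      ≈⟨ +-congˡ (+-congˡ (θ-⋆ (shift f) g n)) ⟩
    (1# + fromℕ n) * f 0 * g (suc n) + (C + (X + Y))
      ≈⟨ solve 6 (λ m a b c x y → (con (+ 1) :+ m) :* a :* b :+ (c :+ (x :+ y))
                              := con (+ 0) :* a :* b :+ (c :+ x) :+ (a :* ((con (+ 1) :+ m) :* b) :+ y))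
           refl (fromℕ n) (f 0) (g (suc n)) C X Y ⟩
    0# * f 0 * g (suc n) + (C + X) + (f 0 * ((1# + fromℕ n) * g (suc n)) + Y)
      ≈⟨ +-congʳ (+-congˡ (trans (⋆-cong (shift-θ f) (λ _ → refl) n) (⋆-distribʳ (shift f) _ g n))) ⟨
    (θ f ⋆ g) (suc n) + (f ⋆ θ g) (suc n) ∎
    where C = (shift f ⋆ g) n
          X = (θ (shift f) ⋆ g) n
          Y = (shift f ⋆ θ g) n

  -- s = −θf/f = −t·f′/f; with this sign Newton's identities say that the power sums
  -- are the log-derivative of the reversed polynomial.
  IsLogDerivative : Series → Series → Set ℓ
  IsLogDerivative f s = ∀ n → θ f n + (f ⋆ s) n ≈ 0#

  logDerivative-⋆ : ∀ {f g s t} → IsLogDerivative f s → IsLogDerivative g t →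
                    IsLogDerivative (f ⋆ g) (s ⊕ t)
  logDerivative-⋆ {f} {g} {s} {t} f-log g-log n = begin
    θ (f ⋆ g) n + ((f ⋆ g) ⋆ (s ⊕ t)) n
      ≈⟨ +-cong (θ-⋆ f g n) (⋆-distribˡ (f ⋆ g) s t n) ⟩
    ((θ f ⋆ g) n + (f ⋆ θ g) n) + (((f ⋆ g) ⋆ s) n + ((f ⋆ g) ⋆ t) n)
      ≈⟨ +-congˡ (+-cong [fg]s≈[fs]g (⋆-assoc f g t n)) ⟩
    ((θ f ⋆ g) n + (f ⋆ θ g) n) + (((f ⋆ s) ⋆ g) n + (f ⋆ (g ⋆ t)) n)
      ≈⟨ interchange _ _ _ _ ⟩
    ((θ f ⋆ g) n + ((f ⋆ s) ⋆ g) n) + ((f ⋆ θ g) n + (f ⋆ (g ⋆ t)) n)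
      ≈⟨ +-cong (⋆-distribʳ (θ f) (f ⋆ s) g n) (⋆-distribˡ f (θ g) (g ⋆ t) n) ⟨
    ((θ f ⊕ f ⋆ s) ⋆ g) n + (f ⋆ (θ g ⊕ g ⋆ t)) n
      ≈⟨ +-cong (⋆-zeroˡ f-log g n) (⋆-zeroʳ f g-log n) ⟩
    0# + 0#
      ≈⟨ +-identityʳ 0# ⟩
    0# ∎
    where
    [fg]s≈[fs]g : ((f ⋆ g) ⋆ s) n ≈ ((f ⋆ s) ⋆ g) n
    [fg]s≈[fs]g = begin
      ((f ⋆ g) ⋆ s) n ≈⟨ ⋆-cong (⋆-comm f g) (λ _ → refl) n ⟩
      ((g ⋆ f) ⋆ s) n ≈⟨ ⋆-assoc g f s n ⟩
      (g ⋆ (f ⋆ s)) n ≈⟨ ⋆-comm g (f ⋆ s) n ⟩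
      ((f ⋆ s) ⋆ g) n ∎

  logDerivative-recurrence : ∀ {f s} → IsLogDerivative f s → s 0 ≈ 0# →
                             ∀ n → fromℕ (suc n) * f (suc n) ≈ - (f ⋆ shift s) n
  logDerivative-recurrence {f} {s} f-log s₀≈0 n = +-inverseˡ-unique _ _ (begin
    fromℕ (suc n) * f (suc n) + (f ⋆ shift s) n
      ≈⟨ +-congˡ (+-identityʳ _) ⟨
    fromℕ (suc n) * f (suc n) + ((f ⋆ shift s) n + 0#)
      ≈⟨ +-congˡ (+-congˡ (trans (*-congˡ s₀≈0) (zeroʳ _))) ⟨
    fromℕ (suc n) * f (suc n) + ((f ⋆ shift s) n + f (suc n) * s 0)
      ≈⟨ +-congˡ (⋆-shiftʳ f s n) ⟨
    θ f (suc n) + (f ⋆ s) (suc n)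
      ≈⟨ f-log (suc n) ⟩
    0# ∎)

  -- In a torsion-free ring the recursion (n+1)·fₙ₊₁ = −Σᵢ≤ₙ fᵢ sₙ₊₁₋ᵢ determines f from f₀ and s.
  logDerivative-unique : TorsionFree R → ∀ {f g s t} L →
                         IsLogDerivative f s → IsLogDerivative g t →
                         s 0 ≈ 0# → s ≈[≤ L ] t → f 0 ≈ g 0 → f ≈[≤ L ] g
  logDerivative-unique tf {f} {g} {s} {t} L f-log g-log s₀≈0 s≈t f₀≈g₀ = agree L ≤-refl
    where
    t₀≈0 : t 0 ≈ 0#
    t₀≈0 = trans (sym (s≈t 0 z≤n)) s₀≈0

    agree : ∀ n → n ≤ L → f ≈[≤ n ] g
    agree zero _ _ z≤n = f₀≈g₀
    agree (suc n) n<L = ≈[≤]-extend n (agree n (<⇒≤ n<L)) (fromℕ-*-cancelˡ tf (suc n) (begin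
      fromℕ (suc n) * f (suc n) ≈⟨ logDerivative-recurrence f-log s₀≈0 n ⟩
      - (f ⋆ shift s) n         ≈⟨ -‿cong (⋆-cong-≤ n (agree n (<⇒≤ n<L)) shift-s≈shift-t) ⟩
      - (g ⋆ shift t) n         ≈⟨ logDerivative-recurrence g-log t₀≈0 n ⟨
      fromℕ (suc n) * g (suc n) ∎))
      where
      shift-s≈shift-t : shift s ≈[≤ n ] shift t
      shift-s≈shift-t i i≤n = s≈t (suc i) (≤-trans (s≤s i≤n) n<L)

  𝟙 : Series
  𝟙 zero = 1#
  𝟙 (suc n) = 0#

  𝟙-logDerivative : IsLogDerivative 𝟙 (λ _ → 0#)
  𝟙-logDerivative zero = trans (+-cong (zeroˡ _) (zeroʳ _)) (+-identityʳ 0#)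
  𝟙-logDerivative (suc n) = trans (+-cong (zeroʳ _) (⋆-zeroʳ 𝟙 (λ _ → refl) (suc n))) (+-identityʳ 0#)

  monomial : ℕ → Carrier → Series
  monomial zero y zero = y
  monomial zero y (suc n) = 0#
  monomial (suc m) y zero = 0#
  monomial (suc m) y (suc n) = monomial m y n

  monomial-diagonal : ∀ m y → monomial m y m ≡ y
  monomial-diagonal zero y = ≡.refl
  monomial-diagonal (suc m) y = monomial-diagonal m y

  monomial-≢ : ∀ m y {n} → n ≢ m → monomial m y n ≡ 0#
  monomial-≢ zero y {zero} n≢m = ⊥-elim (n≢m ≡.refl)
  monomial-≢ zero y {suc n} n≢m = ≡.refl
  monomial-≢ (suc m) y {zero} n≢m = ≡.refl
  monomial-≢ (suc m) y {suc n} n≢m = monomial-≢ m y (λ n≡m → n≢m (cong suc n≡m))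

  ⋆-monomial-< : ∀ f m y {n} → n < m → (f ⋆ monomial m y) n ≈ 0#
  ⋆-monomial-< f (suc m) y {zero} _ = zeroʳ (f 0)
  ⋆-monomial-< f (suc m) y {suc n} (s≤s n<m) =
    trans (⋆-shiftʳ f _ n) (trans (+-cong (⋆-monomial-< f m y n<m) (zeroʳ _)) (+-identityʳ 0#))

  ⋆-monomial-+ : ∀ f m y j → (f ⋆ monomial m y) (m ℕ.+ j) ≈ f j * y
  ⋆-monomial-+ f zero y zero = refl
  ⋆-monomial-+ f zero y (suc j) =
    trans (⋆-shiftʳ f _ j) (trans (+-congʳ (⋆-zeroʳ f (λ _ → refl) j)) (+-identityˡ _))
  ⋆-monomial-+ f (suc m) y j =
    trans (⋆-shiftʳ f _ (m ℕ.+ j)) (trans (+-cong (⋆-monomial-+ f m y j) (zeroʳ _)) (+-identityʳ _))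

  -- the part of s in degrees 1, …, L: the constant term is dropped too
  truncate : ℕ → Series → Series
  truncate zero s n = 0#
  truncate (suc L) s n = truncate L s n + monomial (suc L) (s (suc L)) n

  truncate-> : ∀ L s {n} → L < n → truncate L s n ≈ 0#
  truncate-> zero s _ = refl
  truncate-> (suc L) s {n} L<n = trans (+-cong (truncate-> L s (<⇒≤ L<n))
    (reflexive (monomial-≢ (suc L) _ (λ n≡1+L → <-irrefl (≡.sym n≡1+L) L<n)))) (+-identityʳ 0#)

  truncate-≈ : ∀ L s → s 0 ≈ 0# → truncate L s ≈[≤ L ] s
  truncate-≈ zero s s₀≈0 _ z≤n = sym s₀≈0
  truncate-≈ (suc L) s s₀≈0 = ≈[≤]-extend L
    (λ i i≤L → trans (+-cong (truncate-≈ L s s₀≈0 i i≤L)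
      (reflexive (monomial-≢ (suc L) _ (λ i≡1+L → <-irrefl i≡1+L (s≤s i≤L))))) (+-identityʳ _))
    (trans (+-cong (truncate-> L s (n<1+n L)) (reflexive (monomial-diagonal (suc L) _))) (+-identityˡ _))

  -- the reversed polynomial t^d Q(1/t) = 1 + a₁t + ⋯ + a_d t^d
  coefficients : MonicPoly R → Series
  coefficients Q zero = 1#
  coefficients Q (suc k) = coeff R Q k

  -- degree 0 is 0 rather than p₀(Q) = d, as the log-derivative requires
  powerSums : MonicPoly R → Series
  powerSums Q zero = 0#
  powerSums Q (suc k) = powerSum R Q (suc k)

  negPow*negPow≈1 : ∀ j → negPow R j * negPow R j ≈ 1#
  negPow*negPow≈1 zero = *-identityˡ 1#
  negPow*negPow≈1 (suc j) = trans (sym (-‿distribˡ-* _ _)) (trans (-‿cong (sym (-‿distribʳ-* _ _)))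
    (trans (-‿involutive _) (negPow*negPow≈1 j)))

  negPow*[-negPow*x]≈-x : ∀ j x → negPow R j * (- negPow R j * x) ≈ - x
  negPow*[-negPow*x]≈-x j x = begin
    negPow R j * (- negPow R j * x)   ≈⟨ *-congˡ (-‿distribˡ-* _ _) ⟨
    negPow R j * - (negPow R j * x)   ≈⟨ -‿distribʳ-* _ _ ⟨
    - (negPow R j * (negPow R j * x)) ≈⟨ -‿cong (*-assoc _ _ _) ⟨
    - (negPow R j * negPow R j * x)   ≈⟨ -‿cong (trans (*-congʳ (negPow*negPow≈1 j)) (*-identityˡ x)) ⟩
    - x                               ∎

  newtonSum≈-⋆ : ∀ Q j k → newtonSum R Q (suc j) (powerSumsRev R Q k) ≈
                           - ((λ t → coeff R Q (t ℕ.+ j)) ⋆ powerSums Q) k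
  newtonSum≈-⋆ Q j zero = sym (trans (-‿cong (zeroʳ _)) -0#≈0#)
  newtonSum≈-⋆ Q j (suc k) = begin
    negPow R j * e R Q (suc j) * p + newtonSum R Q (suc (suc j)) (powerSumsRev R Q k)
      ≈⟨ +-cong (*-congʳ (negPow*[-negPow*x]≈-x j (coeff R Q j))) (newtonSum≈-⋆ Q (suc j) k) ⟩
    - coeff R Q j * p + - ((λ t → coeff R Q (t ℕ.+ suc j)) ⋆ powerSums Q) k
      ≈⟨ +-congˡ (-‿cong (⋆-cong (λ t → reflexive (cong (coeff R Q) (ℕₚ.+-suc t j))) (λ _ → refl) k)) ⟩
    - coeff R Q j * p + - ((λ t → coeff R Q (suc t ℕ.+ j)) ⋆ powerSums Q) k
      ≈⟨ trans (sym (-‿+-comm _ _)) (+-congʳ (-‿distribˡ-* _ _)) ⟨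
    - ((λ t → coeff R Q (t ℕ.+ j)) ⋆ powerSums Q) (suc k) ∎
    where p = powerSum R Q (suc k)

  newton-identity : ∀ Q m → powerSum R Q (suc m) ≈
                            - ((shift (coefficients Q) ⋆ powerSums Q) m + fromℕ (suc m) * coeff R Q m)
  newton-identity Q m = begin
    newtonSum R Q 1 (powerSumsRev R Q m) + negPow R m * natMul R (suc m) (e R Q (suc m))
      ≈⟨ +-cong (newtonSum≈-⋆ Q 0 m) (*-congˡ (natMul≈fromℕ* (suc m) _)) ⟩
    - ((λ t → coeff R Q (t ℕ.+ 0)) ⋆ powerSums Q) m + negPow R m * (fromℕ (suc m) * (- negPow R m * a))
      ≈⟨ +-cong (-‿cong (⋆-cong (λ t → reflexive (cong (coeff R Q) (ℕₚ.+-identityʳ t))) (λ _ → refl) m))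
                (x∙yz≈y∙xz _ _ _) ⟩
    - X + fromℕ (suc m) * (negPow R m * (- negPow R m * a))
      ≈⟨ +-congˡ (trans (*-congˡ (negPow*[-negPow*x]≈-x m a)) (sym (-‿distribʳ-* _ _))) ⟩
    - X + - (fromℕ (suc m) * a)
      ≈⟨ -‿+-comm _ _ ⟩
    - (X + fromℕ (suc m) * a) ∎
    where a = coeff R Q m
          X = (shift (coefficients Q) ⋆ powerSums Q) m

  coefficients-logDerivative : ∀ Q → IsLogDerivative (coefficients Q) (powerSums Q)
  coefficients-logDerivative Q zero = trans (+-cong (zeroˡ _) (zeroʳ _)) (+-identityʳ 0#)
  coefficients-logDerivative Q (suc m) = begin
    ma + (1# * powerSum R Q (suc m) + X)
      ≈⟨ +-congˡ (+-congʳ (*-congˡ (newton-identity Q m))) ⟩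
    ma + (1# * - (X + ma) + X)
      ≈⟨ solve 2 (λ n x → n :+ (con (+ 1) :* (:- (x :+ n)) :+ x) := con (+ 0)) refl ma X ⟩
    0# ∎
    where ma = fromℕ (suc m) * coeff R Q m
          X = (shift (coefficients Q) ⋆ powerSums Q) m

module DividedPowerIdeal {c ℓ a : Level} (R : CommutativeRing c ℓ)
  (𝔞 : CommutativeRing.Carrier R → Set a) (𝔞-ideal : IsIdeal R 𝔞) where
  open import Data.Nat.DivMod
    using (_%_; _/_; m≡m%n+[m/n]*n; m<n⇒m%n≡m; %-remove-+ˡ; +-distrib-/-∣ˡ; n/n≡1)
  open import Data.Nat.Divisibility using (∣-refl)
  open import Relation.Nullary using (yes; no)
  open ℕₚ using (_<?_; ≮⇒≥; m≤n⇒∃[o]m+o≡n; _!≢0)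
  open CommutativeRing R
  open IsIdeal 𝔞-ideal
  open PowerSeries R
  open IntegerCoefficients R using (solve; _:+_; _:*_; _:=_)
  open import Algebra.Properties.Ring ring using (-1*x≈-x; -‿distribˡ-*; xyx⁻¹≈y)
  open import Algebra.Properties.Semiring.Mult semiring using (×1-homo-*)
  open import Algebra.Properties.CommutativeSemigroup *-commutativeSemigroup using (x∙yz≈y∙xz)
  open import Relation.Binary.Reasoning.Setoid setoid

  infix 4 _∈_·𝔞
  _∈_·𝔞 : Carrier → ℕ → Set (c ⊔ ℓ ⊔ a)
  x ∈ n ·𝔞 = Σ Carrier λ b → 𝔞 b × x ≈ natMul R n b

  ⋆-closedʳ : ∀ f {g} → (∀ i → 𝔞 (g i)) → ∀ n → 𝔞 ((f ⋆ g) n)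
  ⋆-closedʳ f g∈𝔞 zero = *-closed (f 0) (g∈𝔞 0)
  ⋆-closedʳ f g∈𝔞 (suc n) = +-closed (*-closed (f 0) (g∈𝔞 (suc n))) (⋆-closedʳ (shift f) g∈𝔞 n)

  record IsOneMod𝔞 (E : Series) : Set (ℓ ⊔ a) where
    constructor _,_
    field
      head≈1 : E 0 ≈ 1#
      tail∈𝔞 : ∀ n → 𝔞 (E (suc n))

  ⋆-isOneMod𝔞 : ∀ {E F} → IsOneMod𝔞 E → IsOneMod𝔞 F → IsOneMod𝔞 (E ⋆ F)
  ⋆-isOneMod𝔞 {E} {F} (E₀≈1 , E∈𝔞) (F₀≈1 , F∈𝔞) =
    trans (*-cong E₀≈1 F₀≈1) (*-identityˡ 1#) ,
    λ n → resp (sym (⋆-shiftʳ E F n))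
               (+-closed (⋆-closedʳ E F∈𝔞 n) (resp (*-comm _ _) (*-closed (F 0) (E∈𝔞 n))))

  ⋆-isOneMod𝔞-congruent : ∀ {E} → IsOneMod𝔞 E → ∀ f n → 𝔞 ((f ⋆ E) n - f n)
  ⋆-isOneMod𝔞-congruent (E₀≈1 , _) f zero =
    resp (sym (trans (+-congʳ (trans (*-congˡ E₀≈1) (*-identityʳ _))) (-‿inverseʳ _))) zero∈
  ⋆-isOneMod𝔞-congruent {E} (E₀≈1 , E∈𝔞) f (suc n) = resp (sym (begin
    (f ⋆ E) (suc n) - f (suc n)
      ≈⟨ +-congʳ (trans (⋆-shiftʳ f E n) (+-congˡ (trans (*-congˡ E₀≈1) (*-identityʳ _)))) ⟩
    ((f ⋆ shift E) n + f (suc n)) - f (suc n) ≈⟨ +-assoc _ _ _ ⟩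
    (f ⋆ shift E) n + (f (suc n) - f (suc n)) ≈⟨ +-congˡ (-‿inverseʳ _) ⟩
    (f ⋆ shift E) n + 0#                      ≈⟨ +-identityʳ _ ⟩
    (f ⋆ shift E) n                           ∎)) (⋆-closedʳ f E∈𝔞 n)

  module Exponential (tf : TorsionFree R) (dp : DividedPower R 𝔞) {b} (b∈𝔞 : 𝔞 b) (k : ℕ) where
    m : ℕ
    m = suc k

    -b∈𝔞 : 𝔞 (- b)
    -b∈𝔞 = resp (-1*x≈-x b) (*-closed (- 1#) b∈𝔞)

    -- γ j is a choice of (−b)ʲ / j!
    γ : ℕ → Carrier
    γ zero = 1#
    γ (suc j) = proj₁ (dp (- b) -b∈𝔞 (suc j) (s≤s z≤n))

    γ∈𝔞 : ∀ j → 𝔞 (γ (suc j))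
    γ∈𝔞 j = proj₁ (proj₂ (dp (- b) -b∈𝔞 (suc j) (s≤s z≤n)))

    j!γ≈pow : ∀ j → fromℕ (j !) * γ j ≈ pow R (- b) j
    j!γ≈pow zero = trans (*-identityʳ _) (+-identityʳ 1#)
    j!γ≈pow (suc j) =
      sym (trans (proj₂ (proj₂ (dp (- b) -b∈𝔞 (suc j) (s≤s z≤n)))) (natMul≈fromℕ* (suc j !) _))

    γ-recurrence : ∀ j → fromℕ (suc j) * γ (suc j) ≈ - b * γ j
    γ-recurrence j = fromℕ-*-cancelˡ tf (j !) {{j !≢0}} (begin
      fromℕ (j !) * (fromℕ (suc j) * γ (suc j)) ≈⟨ x∙yz≈y∙xz _ _ _ ⟩
      fromℕ (suc j) * (fromℕ (j !) * γ (suc j)) ≈⟨ *-assoc _ _ _ ⟨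
      fromℕ (suc j) * fromℕ (j !) * γ (suc j)   ≈⟨ *-congʳ (×1-homo-* (suc j) (j !)) ⟨
      fromℕ (suc j !) * γ (suc j)               ≈⟨ j!γ≈pow (suc j) ⟩
      - b * pow R (- b) j                       ≈⟨ *-congˡ (j!γ≈pow j) ⟨
      - b * (fromℕ (j !) * γ j)                 ≈⟨ x∙yz≈y∙xz _ _ _ ⟩
      fromℕ (j !) * (- b * γ j)                 ∎)

    atMultiple : ℕ → ℕ → Carrier
    atMultiple zero q = γ q
    atMultiple (suc _) _ = 0#

    -- exp(−b tᵐ) = Σ_q γ q · t^(q·m)
    E : Series
    E n = atMultiple (n % m) (n / m)

    E-isOneMod𝔞 : IsOneMod𝔞 E
    E-isOneMod𝔞 = refl , λ n → atMultiple∈𝔞 (suc n % m) (suc n / m) (m≡m%n+[m/n]*n (suc n) m)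
      where
      atMultiple∈𝔞 : ∀ {n} r q → suc n ≡ r ℕ.+ q ℕ.* m → 𝔞 (atMultiple r q)
      atMultiple∈𝔞 (suc r) q _ = zero∈
      atMultiple∈𝔞 zero (suc q) _ = γ∈𝔞 q
      atMultiple∈𝔞 zero zero ()

    E-m+ : ∀ j → E (m ℕ.+ j) ≡ atMultiple (j % m) (suc (j / m))
    E-m+ j = ≡.cong₂ atMultiple (%-remove-+ˡ j ∣-refl)
                     (≡.trans (+-distrib-/-∣ˡ j ∣-refl) (cong (ℕ._+ j / m) (n/n≡1 m)))

    θE-< : ∀ {n} → n < m → θ E n ≈ 0#
    θE-< {zero} _ = zeroˡ _
    θE-< {suc n} n<m =
      trans (*-congˡ (reflexive (cong (λ r → atMultiple r (suc n / m)) (m<n⇒m%n≡m n<m)))) (zeroʳ _)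

    θE-m+ : ∀ {y} → y ≈ natMul R m b → ∀ j → θ E (m ℕ.+ j) + E j * y ≈ 0#
    θE-m+ {y} y≈mb j = begin
      fromℕ (m ℕ.+ j) * E (m ℕ.+ j) + E j * y
        ≈⟨ +-cong (*-congˡ (reflexive (E-m+ j))) (*-congˡ (trans y≈mb (natMul≈fromℕ* m b))) ⟩
      fromℕ (m ℕ.+ j) * atMultiple (j % m) (suc (j / m)) + atMultiple (j % m) (j / m) * (fromℕ m * b)
        ≈⟨ vanishes j (j % m) (j / m) (m≡m%n+[m/n]*n j m) ⟩
      0# ∎
      where
      vanishes : ∀ j r q → j ≡ r ℕ.+ q ℕ.* m →
                 fromℕ (m ℕ.+ j) * atMultiple r (suc q) + atMultiple r q * (fromℕ m * b) ≈ 0#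
      vanishes j (suc r) q _ = trans (+-cong (zeroʳ _) (zeroˡ _)) (+-identityʳ 0#)
      vanishes _ zero q ≡.refl = begin
        fromℕ (suc q ℕ.* m) * γ (suc q) + γ q * (fromℕ m * b)
          ≈⟨ +-congʳ (*-congʳ (×1-homo-* (suc q) m)) ⟩
        fromℕ (suc q) * fromℕ m * γ (suc q) + γ q * (fromℕ m * b)
          ≈⟨ solve 5 (λ a n g g′ b → a :* n :* g′ :+ g :* (n :* b) := n :* (a :* g′ :+ b :* g))
               refl (fromℕ (suc q)) (fromℕ m) (γ q) (γ (suc q)) b ⟩
        fromℕ m * (fromℕ (suc q) * γ (suc q) + b * γ q)
          ≈⟨ *-congˡ (+-congʳ (γ-recurrence q)) ⟩
        fromℕ m * (- b * γ q + b * γ q)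
          ≈⟨ *-congˡ (trans (+-congʳ (sym (-‿distribˡ-* _ _))) (-‿inverseˡ _)) ⟩
        fromℕ m * 0#
          ≈⟨ zeroʳ _ ⟩
        0# ∎

    E-logDerivative : ∀ {y} → y ≈ natMul R m b → IsLogDerivative E (monomial m y)
    E-logDerivative y≈mb n with n <? m
    ... | yes n<m = trans (+-cong (θE-< n<m) (⋆-monomial-< E m _ n<m)) (+-identityʳ 0#)
    ... | no n≮m with m≤n⇒∃[o]m+o≡n (≮⇒≥ n≮m)
    ...   | j , ≡.refl = trans (+-congˡ (⋆-monomial-+ E m _ j)) (θE-m+ y≈mb j)

  exponential : TorsionFree R → DividedPower R 𝔞 → ∀ k {y} → y ∈ suc k ·𝔞 →
                Σ Series λ E → IsOneMod𝔞 E × IsLogDerivative E (monomial (suc k) y)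
  exponential tf dp k (b , b∈𝔞 , y≈mb) = E , E-isOneMod𝔞 , E-logDerivative y≈mb
    where open Exponential tf dp b∈𝔞 k

  truncatedExponential : TorsionFree R → DividedPower R 𝔞 →
                         ∀ L s → (∀ k → suc k ≤ L → s (suc k) ∈ suc k ·𝔞) →
                         Σ Series λ E → IsOneMod𝔞 E × IsLogDerivative E (truncate L s)
  truncatedExponential tf dp zero s _ = 𝟙 , (refl , λ _ → zero∈) , 𝟙-logDerivative
  truncatedExponential tf dp (suc L) s s∈𝔞
    with truncatedExponential tf dp L s (λ k k<L → s∈𝔞 k (m≤n⇒m≤1+n k<L))
       | exponential tf dp L (s∈𝔞 L ≤-refl)
  ... | E , E-isOneMod𝔞 , E-log | F , F-isOneMod𝔞 , F-log =
    E ⋆ F , ⋆-isOneMod𝔞 E-isOneMod𝔞 F-isOneMod𝔞 , logDerivative-⋆ E-log F-log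

  coefficients-congruent : TorsionFree R → DividedPower R 𝔞 → ∀ P Q L →
    (∀ k → suc k ≤ L → powerSum R P (suc k) - powerSum R Q (suc k) ∈ suc k ·𝔞) →
    ∀ n → n ≤ L → 𝔞 (coefficients P n - coefficients Q n)
  coefficients-congruent tf dp P Q L δ∈𝔞 = congruent (truncatedExponential tf dp L δ δ∈𝔞)
    where
    δ : Series
    δ n = powerSums P n - powerSums Q n

    powerSums-agree : powerSums P ≈[≤ L ] powerSums Q ⊕ truncate L δ
    powerSums-agree i i≤L = sym (begin
      powerSums Q i + truncate L δ i                ≈⟨ +-congˡ (truncate-≈ L δ (-‿inverseʳ 0#) i i≤L) ⟩
      powerSums Q i + δ i                           ≈⟨ +-assoc _ _ _ ⟨
      powerSums Q i + powerSums P i - powerSums Q i ≈⟨ xyx⁻¹≈y _ _ ⟩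
      powerSums P i                                 ∎)

    congruent : Σ Series (λ E → IsOneMod𝔞 E × IsLogDerivative E (truncate L δ)) →
                ∀ n → n ≤ L → 𝔞 (coefficients P n - coefficients Q n)
    congruent (E , E-isOneMod𝔞 , E-log) n n≤L =
      resp (+-congʳ (sym (P≈Q⋆E n n≤L))) (⋆-isOneMod𝔞-congruent E-isOneMod𝔞 (coefficients Q) n)
      where
      P≈Q⋆E : coefficients P ≈[≤ L ] coefficients Q ⋆ E
      P≈Q⋆E = logDerivative-unique tf L (coefficients-logDerivative P)
        (logDerivative-⋆ (coefficients-logDerivative Q) E-log) refl powerSums-agree
        (sym (trans (*-identityˡ _) (IsOneMod𝔞.head≈1 E-isOneMod𝔞)))

proposition2p11 : ∀ {c ℓ a : Level} (R : CommutativeRing c ℓ) (p : ℕ) → Prime p →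
    TorsionFree R → ZpAlgebra R p →
    (I : CommutativeRing.Carrier R → Set a) → IsIdeal R I → DividedPower R I →
    (P Q : MonicPoly R) (N : ℕ) → 1 ≤ N →
    (∀ (n : ℕ) → 1 ≤ n → n ≤ N → CongModMul R I n (powerSum R P n) (powerSum R Q n)) →
    ∀ (n : ℕ) → 1 ≤ n → n ≤ N → CongMod R I (e R P n) (e R Q n)
proposition2p11 R p _ tf _ I I-ideal dp P Q N _ hyp (suc k) _ 1+k≤N =
  resp (x[y-z]≈xy-xz (negPow R (suc k)) _ _)
       (*-closed (negPow R (suc k))
                 (coefficients-congruent tf dp P Q N (λ j → hyp (suc j) (s≤s z≤n)) (suc k) 1+k≤N))
  where
  open CommutativeRing R
  open import Algebra.Properties.Ring ring using (x[y-z]≈xy-xz)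
  open IsIdeal I-ideal
  open DividedPowerIdeal R I I-ideal using (coefficients-congruent)
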